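{- Let $\mathcal M$ be a class of Kripke models that admits filtration with respect to $\mathsf{ML}$. Suppose that for every model $\mathbb S=(S,R,V)\in\mathcal M$ and every finite FL-closed set $\Sigma\subset\mu_c\mathsf{ML}$ there are a valuation $V':\mathsf P\to\mathcal P(S)$ and a map $\tau:\Sigma\to\mathsf{ML}$ such that: (1) $V'(p)=V(p)$ for every $p\in\mathsf P$ occurring in $\Sigma$; (2) the model $\mathbb S'=(S,R,V')$ belongs to $\mathcal M$; (3) the set $\tau[\Sigma]\subset\mathsf{ML}$ is FL-closed; (4) $\tau(\Box\varphi)=\Box\tau(\varphi)$ for all $\Box\varphi\in\Sigma$; (5) for every $\xi\in\Sigma$ and $s\in S$: $\mathbb S,s\Vdash\xi\iff\mathbb S',s\Vdash\tau(\xi)$. Then $\mathcal M$ admits filtration with respect to $\mu_c\mathsf{ML}$.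
   Context: $\mathsf{ML}$ is the basic modal language (in negation normal form: literals $p,\neg p$, $\lor,\land,\Diamond,\Box$) over a countably infinite set $\mathsf P$ of variables. $\mu_c\mathsf{ML}$ (continuous modal $\mu$-calculus) extends it with fixpoint formulas: formulas are $p\mid\neg p\mid\varphi\lor\varphi\mid\varphi\land\varphi\mid\Diamond\varphi\mid\Box\varphi\mid\mu x.\varphi'\mid\nu x.\varphi''$ where $\varphi'\in\mathsf{Con}_{\{x\}}$, $\varphi''\in\mathsf{Cocon}_{\{x\}}$; here $\mathsf{Con}_X$ is generated by $x\in X$, $X$-free formulas of $\mu_c\mathsf{ML}$, $\lor,\land,\Diamond$ and $\mu y.\varphi'$ with $\varphi'\in\mathsf{Con}_{X\cup\{y\}}$, and $\mathsf{Cocon}_X$ dually with $\Box$ and $\nu$. Semantics in Kripke models $(S,R,V)$ is standard, with $\mu$/$\nu$ as least/greatest fixpoints. Formulas are assumed tidy (free and bound variables disjoint). FL-closure of a set $\Phi$: least $\Psi\supseteq\Phi$ closed under $\neg p\mapsto p$, $\varphi\circ\psi\mapsto\varphi,\psi$ ($\circ\in\{\lor,\land\}$), $\heartsuit\varphi\mapsto\varphi$ ($\heartsuit\in\{\Diamond,\Box\}$), $\eta x.\varphi\mapsto\varphi[\eta x.\varphi/x]$; FL-closed means equal to its closure. For a finite FL-closed $\Sigma$ and model $\mathbb S=(S,R,V)$, let $s\sim_\Sigma s'$ iff $s,s'$ satisfy the same formulas of $\Sigma$. A filtration of $\mathbb S$ through $\Sigma$ is a model $(S/{\sim_\Sigma},R^\Sigma,V^\Sigma)$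 with $R^{\min}\subseteq R^\Sigma\subseteq R^{\max}$, where $\overline sR^{\min}\overline t$ iff $Rs't'$ for some $s'\sim_\Sigma s,t'\sim_\Sigma t$, and $\overline sR^{\max}\overline t$ iff for all $\Box\varphi\in\Sigma$, $s\Vdash\Box\varphi$ implies $t\Vdash\varphi$; and $V^\Sigma(p)=\{\overline s:s\Vdash p\}$ for variables $p\in\Sigma$. A class $\mathcal M$ of models admits filtration with respect to a language $\mathsf D$ if for every $\mathbb S\in\mathcal M$ and every finite FL-closed set $\Sigma$ of $\mathsf D$-formulas, $\mathcal M$ contains a filtration of $\mathbb S$ through $\Sigma$. -}

module Defs where

open import Level using (Level; 0ℓ) renaming (suc to lsuc)
open import Data.Nat using (ℕ; zero; suc; _≟_)
open import Data.Bool using (if_then_else_)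
open import Data.Empty using (⊥)
open import Data.Unit using (⊤)
open import Data.Product using (Σ; Σ-syntax; ∃; ∃-syntax; _×_; _,_)
open import Data.Sum using (_⊎_)
open import Data.List using (List; []; _∷_; map; [_])
open import Data.List.Relation.Unary.All using (All)
open import Data.List.Membership.Propositional using (_∈_)
open import Relation.Nullary using (¬_; does)
open import Relation.Binary.PropositionalEquality using (_≡_)
open import Function.Bundles using (_⇔_)

-- Syntax (negation normal form).  Variables P = ℕ (countably infinite);
-- fixpoint variables are taken from the same set P.

infixr 6 _∧_
infixr 5 _∨_

data Fm : Set where
  var  : ℕ → Fm
  nvar : ℕ → Fm
  _∨_  : Fm → Fm → Fm
  _∧_  : Fm → Fm → Fm
  ◇    : Fm → Fm
  □    : Fm → Fm
  μ    : ℕ → Fm → Fm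
  ν    : ℕ → Fm → Fm

data FreeIn (x : ℕ) : Fm → Set where
  f-var  : FreeIn x (var x)
  f-nvar : FreeIn x (nvar x)
  f-∨ˡ   : ∀ {φ ψ} → FreeIn x φ → FreeIn x (φ ∨ ψ)
  f-∨ʳ   : ∀ {φ ψ} → FreeIn x ψ → FreeIn x (φ ∨ ψ)
  f-∧ˡ   : ∀ {φ ψ} → FreeIn x φ → FreeIn x (φ ∧ ψ)
  f-∧ʳ   : ∀ {φ ψ} → FreeIn x ψ → FreeIn x (φ ∧ ψ)
  f-◇    : ∀ {φ} → FreeIn x φ → FreeIn x (◇ φ)
  f-□    : ∀ {φ} → FreeIn x φ → FreeIn x (□ φ)
  f-μ    : ∀ {y φ} → ¬ (x ≡ y) → FreeIn x φ → FreeIn x (μ y φ)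
  f-ν    : ∀ {y φ} → ¬ (x ≡ y) → FreeIn x φ → FreeIn x (ν y φ)

data BoundIn (x : ℕ) : Fm → Set where
  b-∨ˡ  : ∀ {φ ψ} → BoundIn x φ → BoundIn x (φ ∨ ψ)
  b-∨ʳ  : ∀ {φ ψ} → BoundIn x ψ → BoundIn x (φ ∨ ψ)
  b-∧ˡ  : ∀ {φ ψ} → BoundIn x φ → BoundIn x (φ ∧ ψ)
  b-∧ʳ  : ∀ {φ ψ} → BoundIn x ψ → BoundIn x (φ ∧ ψ)
  b-◇   : ∀ {φ} → BoundIn x φ → BoundIn x (◇ φ)
  b-□   : ∀ {φ} → BoundIn x φ → BoundIn x (□ φ)
  b-μ   : ∀ {φ} → BoundIn x (μ x φ)
  b-ν   : ∀ {φ} → BoundIn x (ν x φ)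
  b-μ′  : ∀ {y φ} → BoundIn x φ → BoundIn x (μ y φ)
  b-ν′  : ∀ {y φ} → BoundIn x φ → BoundIn x (ν y φ)

data Occurs (x : ℕ) : Fm → Set where
  o-var  : Occurs x (var x)
  o-nvar : Occurs x (nvar x)
  o-∨ˡ   : ∀ {φ ψ} → Occurs x φ → Occurs x (φ ∨ ψ)
  o-∨ʳ   : ∀ {φ ψ} → Occurs x ψ → Occurs x (φ ∨ ψ)
  o-∧ˡ   : ∀ {φ ψ} → Occurs x φ → Occurs x (φ ∧ ψ)
  o-∧ʳ   : ∀ {φ ψ} → Occurs x ψ → Occurs x (φ ∧ ψ)
  o-◇    : ∀ {φ} → Occurs x φ → Occurs x (◇ φ)
  o-□    : ∀ {φ} → Occurs x φ → Occurs x (□ φ)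
  o-μ    : ∀ {φ} → Occurs x (μ x φ)
  o-ν    : ∀ {φ} → Occurs x (ν x φ)
  o-μ′   : ∀ {y φ} → Occurs x φ → Occurs x (μ y φ)
  o-ν′   : ∀ {y φ} → Occurs x φ → Occurs x (ν y φ)

Tidy : Fm → Set
Tidy φ = ∀ x → FreeIn x φ → ¬ BoundIn x φ

_-free_ : List ℕ → Fm → Set
X -free φ = ∀ x → x ∈ X → ¬ FreeIn x φ

data IsML : Fm → Set where
  var  : ∀ p → IsML (var p)
  nvar : ∀ p → IsML (nvar p)
  _∨_  : ∀ {φ ψ} → IsML φ → IsML ψ → IsML (φ ∨ ψ)
  _∧_  : ∀ {φ ψ} → IsML φ → IsML ψ → IsML (φ ∧ ψ)
  ◇    : ∀ {φ} → IsML φ → IsML (◇ φ)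
  □    : ∀ {φ} → IsML φ → IsML (□ φ)

mutual
  data IsμcML : Fm → Set where
    var  : ∀ p → IsμcML (var p)
    nvar : ∀ p → IsμcML (nvar p)
    _∨_  : ∀ {φ ψ} → IsμcML φ → IsμcML ψ → IsμcML (φ ∨ ψ)
    _∧_  : ∀ {φ ψ} → IsμcML φ → IsμcML ψ → IsμcML (φ ∧ ψ)
    ◇    : ∀ {φ} → IsμcML φ → IsμcML (◇ φ)
    □    : ∀ {φ} → IsμcML φ → IsμcML (□ φ)
    μ    : ∀ {x φ} → Con [ x ] φ → IsμcML (μ x φ)
    ν    : ∀ {x φ} → Cocon [ x ] φ → IsμcML (ν x φ)

  data Con (X : List ℕ) : Fm → Set where
    var  : ∀ {x} → x ∈ X → Con X (var x)
    free : ∀ {φ} → X -free φ → IsμcML φ → Con X φ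
    _∨_  : ∀ {φ ψ} → Con X φ → Con X ψ → Con X (φ ∨ ψ)
    _∧_  : ∀ {φ ψ} → Con X φ → Con X ψ → Con X (φ ∧ ψ)
    ◇    : ∀ {φ} → Con X φ → Con X (◇ φ)
    μ    : ∀ {y φ} → Con (y ∷ X) φ → Con X (μ y φ)

  data Cocon (X : List ℕ) : Fm → Set where
    var  : ∀ {x} → x ∈ X → Cocon X (var x)
    free : ∀ {φ} → X -free φ → IsμcML φ → Cocon X φ
    _∨_  : ∀ {φ ψ} → Cocon X φ → Cocon X ψ → Cocon X (φ ∨ ψ)
    _∧_  : ∀ {φ ψ} → Cocon X φ → Cocon X ψ → Cocon X (φ ∧ ψ)
    □    : ∀ {φ} → Cocon X φ → Cocon X (□ φ)
    ν    : ∀ {y φ} → Cocon (y ∷ X) φ → Cocon X (ν y φ)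

-- formulas of μ_c ML (tidy, per the standing convention)
MuC : Fm → Set
MuC φ = IsμcML φ × Tidy φ

-- Substitution φ[ψ/x] (capture is impossible for tidy formulas)

_[_/_] : Fm → Fm → ℕ → Fm
var y    [ ψ / x ] = if does (x ≟ y) then ψ else var y
nvar y   [ ψ / x ] = nvar y
(φ ∨ χ)  [ ψ / x ] = (φ [ ψ / x ]) ∨ (χ [ ψ / x ])
(φ ∧ χ)  [ ψ / x ] = (φ [ ψ / x ]) ∧ (χ [ ψ / x ])
◇ φ      [ ψ / x ] = ◇ (φ [ ψ / x ])
□ φ      [ ψ / x ] = □ (φ [ ψ / x ])
μ y φ    [ ψ / x ] = if does (x ≟ y) then μ y φ else μ y (φ [ ψ / x ])
ν y φ    [ ψ / x ] = if does (x ≟ y) then ν y φ else ν y (φ [ ψ / x ])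

data InFL (Φ : List Fm) : Fm → Set where
  base : ∀ {φ} → φ ∈ Φ → InFL Φ φ
  neg  : ∀ {p} → InFL Φ (nvar p) → InFL Φ (var p)
  ∨ˡ   : ∀ {φ ψ} → InFL Φ (φ ∨ ψ) → InFL Φ φ
  ∨ʳ   : ∀ {φ ψ} → InFL Φ (φ ∨ ψ) → InFL Φ ψ
  ∧ˡ   : ∀ {φ ψ} → InFL Φ (φ ∧ ψ) → InFL Φ φ
  ∧ʳ   : ∀ {φ ψ} → InFL Φ (φ ∧ ψ) → InFL Φ ψ
  dia  : ∀ {φ} → InFL Φ (◇ φ) → InFL Φ φ
  box  : ∀ {φ} → InFL Φ (□ φ) → InFL Φ φ
  unμ  : ∀ {x φ} → InFL Φ (μ x φ) → InFL Φ (φ [ μ x φ / x ])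
  unν  : ∀ {x φ} → InFL Φ (ν x φ) → InFL Φ (φ [ ν x φ / x ])

FLClosed : List Fm → Set
FLClosed Φ = ∀ φ → InFL Φ φ → φ ∈ Φ

record Model : Set₁ where
  constructor ⟨_,_,_⟩
  field
    S : Set
    R : S → S → Set
    V : ℕ → S → Set
open Model public

Pred : Set → Set₁
Pred A = A → Set

update : {A : Set} → (ℕ → Pred A) → ℕ → Pred A → ℕ → Pred A
update V x X y = if does (x ≟ y) then X else V y

iter : ∀ {a} {A : Set a} → (A → A) → ℕ → A → A
iter f zero    a = a
iter f (suc n) a = f (iter f n a)

⟦_⟧ : Fm → {S : Set} → (S → S → Set) → (ℕ → Pred S) → Pred S
⟦ var p ⟧  R V s = V p s
⟦ nvar p ⟧ R V s = ¬ V p s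
⟦ φ ∨ ψ ⟧  R V s = ⟦ φ ⟧ R V s ⊎ ⟦ ψ ⟧ R V s
⟦ φ ∧ ψ ⟧  R V s = ⟦ φ ⟧ R V s × ⟦ ψ ⟧ R V s
⟦ ◇ φ ⟧    R V s = Σ[ t ∈ _ ] (R s t × ⟦ φ ⟧ R V t)
⟦ □ φ ⟧    R V s = ∀ t → R s t → ⟦ φ ⟧ R V t
⟦ μ x φ ⟧  R V s = Σ[ n ∈ ℕ ] iter (λ X → ⟦ φ ⟧ R (update V x X)) n (λ _ → ⊥) s
⟦ ν x φ ⟧  R V s = ∀ (n : ℕ) → iter (λ X → ⟦ φ ⟧ R (update V x X)) n (λ _ → ⊤) s

_,_⊩_ : (𝕊 : Model) → S 𝕊 → Fm → Set
𝕊 , s ⊩ φ = ⟦ φ ⟧ (R 𝕊) (V 𝕊) s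

_∼[_]_ : {𝕊 : Model} → S 𝕊 → List Fm → S 𝕊 → Set
_∼[_]_ {𝕊} s Σ' s' = ∀ φ → φ ∈ Σ' → (𝕊 , s ⊩ φ) ⇔ (𝕊 , s' ⊩ φ)

-- 𝕋 is a filtration of 𝕊 through Σ.  The quotient S/∼_Σ is presented by
-- a surjection q : S → S 𝕋 whose kernel is exactly ∼_Σ (q s = s̄).
record IsFiltration (𝕊 : Model) (Σ' : List Fm) (𝕋 : Model) : Set where
  field
    q      : S 𝕊 → S 𝕋
    q-surj : ∀ a → ∃[ s ] (q s ≡ a)
    q-ker  : ∀ s s' → (q s ≡ q s') ⇔ (_∼[_]_ {𝕊} s Σ' s')
    -- R^min ⊆ R^Σ
    min⊆   : ∀ a b → (∃[ s' ] ∃[ t' ] (q s' ≡ a × q t' ≡ b × R 𝕊 s' t'))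
             → R 𝕋 a b
    -- R^Σ ⊆ R^max
    ⊆max   : ∀ a b → R 𝕋 a b → ∀ s t → q s ≡ a → q t ≡ b →
             ∀ φ → □ φ ∈ Σ' → 𝕊 , s ⊩ □ φ → 𝕊 , t ⊩ φ
    val    : ∀ p → var p ∈ Σ' → ∀ s → V 𝕋 p (q s) ⇔ V 𝕊 p s

AdmitsFiltration : (Model → Set₁) → (Fm → Set) → Set₁
AdmitsFiltration 𝓜 D =
  ∀ (𝕊 : Model) → 𝓜 𝕊 → ∀ (Σ' : List Fm) → All D Σ' → FLClosed Σ' →
  Σ[ 𝕋 ∈ Model ] (𝓜 𝕋 × IsFiltration 𝕊 Σ' 𝕋)

TranslationHyp : (Model → Set₁) → Set₁
TranslationHyp 𝓜 =
  ∀ (𝕊 : Model) → 𝓜 𝕊 → ∀ (Σ' : List Fm) → All MuC Σ' → FLClosed Σ' →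
  Σ[ V' ∈ (ℕ → Pred (S 𝕊)) ] Σ[ τ ∈ (Fm → Fm) ]
    ( (∀ ξ → ξ ∈ Σ' → IsML (τ ξ))
    × (∀ p → (∃[ φ ] (φ ∈ Σ' × Occurs p φ)) → ∀ s → V' p s ⇔ V 𝕊 p s)
    × 𝓜 ⟨ S 𝕊 , R 𝕊 , V' ⟩
    × FLClosed (map τ Σ')
    × (∀ φ → □ φ ∈ Σ' → τ (□ φ) ≡ □ (τ φ))
    × (∀ ξ → ξ ∈ Σ' → ∀ s →
         (𝕊 , s ⊩ ξ) ⇔ (⟨ S 𝕊 , R 𝕊 , V' ⟩ , s ⊩ τ ξ)) )

{-# OPTIONS --safe #-}
module Submission where

-- Filter the revalued model 𝕊' = (S, R, V') through the ML-set τ[Σ] together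
-- with the propositional variables of Σ.  By (5) and (1) this set induces on S
-- the same equivalence as Σ does in 𝕊, and by (4) each □φ ∈ Σ is matched by the
-- box □τ(φ) of the set, so a filtration of 𝕊' is already a filtration of 𝕊
-- through Σ.  The variables of Σ are added because a filtration only fixes the
-- valuation of variables in the filtering set, and τ need not keep them.

open import Defs
open import Data.Nat using (ℕ)
open import Data.Product using (∃-syntax; _×_; _,_)
open import Data.Sum as Sum using (_⊎_; inj₁; inj₂; [_,_]′)
open import Data.List using (List; map; _++_; filter)
open import Data.List.Relation.Unary.All as All using (All)
open import Data.List.Relation.Unary.All.Properties using (++⁺; map⁺; all-filter)
open import Data.List.Membership.Propositional using (_∈_)
open import Data.List.Membership.Propositional.Properties
  using (∈-map⁺; ∈-map⁻; ∈-++⁺ˡ; ∈-++⁺ʳ; ∈-++⁻; ∈-filter⁺; ∈-filter⁻)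
open import Relation.Nullary using (yes; no)
open import Relation.Unary using (Decidable)
open import Relation.Binary.PropositionalEquality using (_≡_; refl; subst)
open import Function using (_∘_; case_of_)
open import Function.Bundles using (_⇔_; mk⇔; Equivalence)
import Function.Properties.Equivalence as ⇔
open Equivalence using (to; from)

data IsVar : Fm → Set where
  var : ∀ p → IsVar (var p)

isVar? : Decidable IsVar
isVar? (var p)  = yes (var p)
isVar? (nvar _) = no λ ()
isVar? (_ ∨ _)  = no λ ()
isVar? (_ ∧ _)  = no λ ()
isVar? (◇ _)    = no λ ()
isVar? (□ _)    = no λ ()
isVar? (μ _ _)  = no λ ()
isVar? (ν _ _)  = no λ ()

IsVar⇒IsML : ∀ {φ} → IsVar φ → IsML φ
IsVar⇒IsML (var p) = var p

variables : List Fm → List Fm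
variables = filter isVar?

InFL-++⁻ : ∀ A {B φ} → InFL (A ++ B) φ → InFL A φ ⊎ InFL B φ
InFL-++⁻ A (base m) = Sum.map base base (∈-++⁻ A m)
InFL-++⁻ A (neg d)  = Sum.map neg neg (InFL-++⁻ A d)
InFL-++⁻ A (∨ˡ d)   = Sum.map ∨ˡ ∨ˡ (InFL-++⁻ A d)
InFL-++⁻ A (∨ʳ d)   = Sum.map ∨ʳ ∨ʳ (InFL-++⁻ A d)
InFL-++⁻ A (∧ˡ d)   = Sum.map ∧ˡ ∧ˡ (InFL-++⁻ A d)
InFL-++⁻ A (∧ʳ d)   = Sum.map ∧ʳ ∧ʳ (InFL-++⁻ A d)
InFL-++⁻ A (dia d)  = Sum.map dia dia (InFL-++⁻ A d)
InFL-++⁻ A (box d)  = Sum.map box box (InFL-++⁻ A d)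
InFL-++⁻ A (unμ d)  = Sum.map unμ unμ (InFL-++⁻ A d)
InFL-++⁻ A (unν d)  = Sum.map unν unν (InFL-++⁻ A d)

FLClosed-++ : ∀ {A B} → FLClosed A → FLClosed B → FLClosed (A ++ B)
FLClosed-++ {A} A-closed B-closed φ d =
  [ ∈-++⁺ˡ ∘ A-closed φ , ∈-++⁺ʳ A ∘ B-closed φ ]′ (InFL-++⁻ A d)

FLClosed-vars : ∀ {B} → All IsVar B → FLClosed B
FLClosed-vars vs _ (base m) = m
FLClosed-vars vs _ (neg d)  = case All.lookup vs (FLClosed-vars vs _ d) of λ ()
FLClosed-vars vs _ (∨ˡ d)   = case All.lookup vs (FLClosed-vars vs _ d) of λ ()
FLClosed-vars vs _ (∨ʳ d)   = case All.lookup vs (FLClosed-vars vs _ d) of λ ()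
FLClosed-vars vs _ (∧ˡ d)   = case All.lookup vs (FLClosed-vars vs _ d) of λ ()
FLClosed-vars vs _ (∧ʳ d)   = case All.lookup vs (FLClosed-vars vs _ d) of λ ()
FLClosed-vars vs _ (dia d)  = case All.lookup vs (FLClosed-vars vs _ d) of λ ()
FLClosed-vars vs _ (box d)  = case All.lookup vs (FLClosed-vars vs _ d) of λ ()
FLClosed-vars vs _ (unμ d)  = case All.lookup vs (FLClosed-vars vs _ d) of λ ()
FLClosed-vars vs _ (unν d)  = case All.lookup vs (FLClosed-vars vs _ d) of λ ()

FLClosed-variables : ∀ Σ' → FLClosed (variables Σ')
FLClosed-variables Σ' = FLClosed-vars (all-filter isVar? Σ')

module Revaluation (𝕊 : Model) (V' : ℕ → Pred (S 𝕊)) where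

  𝕊' : Model
  𝕊' = ⟨ S 𝕊 , R 𝕊 , V' ⟩

  Agree : Fm → Fm → Set
  Agree φ ψ = ∀ s → (𝕊 , s ⊩ φ) ⇔ (𝕊' , s ⊩ ψ)

  record Simulation (Σ' Γ : List Fm) : Set where
    field
      sound    : ∀ ξ → ξ ∈ Σ' → ∃[ γ ] (γ ∈ Γ × Agree ξ γ)
      complete : ∀ γ → γ ∈ Γ → ∃[ ξ ] (ξ ∈ Σ' × Agree ξ γ)
      boxes    : ∀ φ → □ φ ∈ Σ' → ∃[ χ ] (□ χ ∈ Γ × Agree (□ φ) (□ χ) × Agree φ χ)
      vars     : ∀ p → var p ∈ Σ' → var p ∈ Γ × Agree (var p) (var p)

  module _ {Σ' Γ : List Fm} (sim : Simulation Σ' Γ) where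
    open Simulation sim

    ∼-reflect : ∀ s s' → _∼[_]_ {𝕊'} s Γ s' → _∼[_]_ {𝕊} s Σ' s'
    ∼-reflect s s' s∼s' ξ ξ∈Σ with sound ξ ξ∈Σ
    ... | γ , γ∈Γ , ξ≈γ = ⇔.trans (ξ≈γ s) (⇔.trans (s∼s' γ γ∈Γ) (⇔.sym (ξ≈γ s')))

    ∼-preserve : ∀ s s' → _∼[_]_ {𝕊} s Σ' s' → _∼[_]_ {𝕊'} s Γ s'
    ∼-preserve s s' s∼s' γ γ∈Γ with complete γ γ∈Γ
    ... | ξ , ξ∈Σ , ξ≈γ = ⇔.trans (⇔.sym (ξ≈γ s)) (⇔.trans (s∼s' ξ ξ∈Σ) (ξ≈γ s'))

    IsFiltration-transfer : ∀ {𝕋} → IsFiltration 𝕊' Γ 𝕋 → IsFiltration 𝕊 Σ' 𝕋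
    IsFiltration-transfer {𝕋} F = record
      { q      = q
      ; q-surj = q-surj
      ; q-ker  = λ s s' → ⇔.trans (q-ker s s') (mk⇔ (∼-reflect s s') (∼-preserve s s'))
      ; min⊆   = min⊆
      ; ⊆max   = ⊆max′
      ; val    = val′
      }
      where
        open IsFiltration F
        ⊆max′ : ∀ a b → R 𝕋 a b → ∀ s t → q s ≡ a → q t ≡ b →
                ∀ φ → □ φ ∈ Σ' → 𝕊 , s ⊩ □ φ → 𝕊 , t ⊩ φ
        ⊆max′ a b aRb s t qs≡a qt≡b φ □φ∈Σ s⊩□φ with boxes φ □φ∈Σ
        ... | χ , □χ∈Γ , □φ≈□χ , φ≈χ =
          from (φ≈χ t) (⊆max a b aRb s t qs≡a qt≡b χ □χ∈Γ (to (□φ≈□χ s) s⊩□φ))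

        val′ : ∀ p → var p ∈ Σ' → ∀ s → V 𝕋 p (q s) ⇔ V 𝕊 p s
        val′ p p∈Σ s with vars p p∈Σ
        ... | p∈Γ , p≈p = ⇔.trans (val p p∈Γ s) (⇔.sym (p≈p s))

  translation-simulation : ∀ {Σ'} (τ : Fm → Fm) → FLClosed Σ' →
    (∀ p → var p ∈ Σ' → Agree (var p) (var p)) →
    (∀ φ → □ φ ∈ Σ' → τ (□ φ) ≡ □ (τ φ)) →
    (∀ ξ → ξ ∈ Σ' → Agree ξ (τ ξ)) →
    Simulation Σ' (map τ Σ' ++ variables Σ')
  translation-simulation {Σ'} τ Σ-closed var-agree τ-□ τ-agree = record
    { sound    = λ ξ ξ∈Σ → τ ξ , τ[Σ]⊆Γ ξ∈Σ , τ-agree ξ ξ∈Σ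
    ; complete = complete
    ; boxes    = boxes
    ; vars     = λ p p∈Σ → ∈-++⁺ʳ (map τ Σ') (∈-filter⁺ isVar? p∈Σ (var p)) , var-agree p p∈Σ
    }
    where
      τ[Σ]⊆Γ : ∀ {ξ} → ξ ∈ Σ' → τ ξ ∈ map τ Σ' ++ variables Σ'
      τ[Σ]⊆Γ = ∈-++⁺ˡ ∘ ∈-map⁺ τ

      complete : ∀ γ → γ ∈ map τ Σ' ++ variables Σ' → ∃[ ξ ] (ξ ∈ Σ' × Agree ξ γ)
      complete γ γ∈Γ with ∈-++⁻ (map τ Σ') γ∈Γ
      ... | inj₁ γ∈τ[Σ] with ∈-map⁻ τ γ∈τ[Σ]
      ...   | ξ , ξ∈Σ , refl = ξ , ξ∈Σ , τ-agree ξ ξ∈Σ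
      complete γ γ∈Γ | inj₂ γ∈vars with ∈-filter⁻ isVar? {xs = Σ'} γ∈vars
      ...   | p∈Σ , var p = var p , p∈Σ , var-agree p p∈Σ

      boxes : ∀ φ → □ φ ∈ Σ' →
              ∃[ χ ] (□ χ ∈ map τ Σ' ++ variables Σ' × Agree (□ φ) (□ χ) × Agree φ χ)
      boxes φ □φ∈Σ =
          τ φ
        , subst (_∈ map τ Σ' ++ variables Σ') τ□φ≡□τφ (τ[Σ]⊆Γ □φ∈Σ)
        , subst (Agree (□ φ)) τ□φ≡□τφ (τ-agree (□ φ) □φ∈Σ)
        , τ-agree φ (Σ-closed φ (box (base □φ∈Σ)))
        where τ□φ≡□τφ = τ-□ φ □φ∈Σ

lemma3p4 : (𝓜 : Model → Set₁) → AdmitsFiltration 𝓜 IsML → TranslationHyp 𝓜 →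
    AdmitsFiltration 𝓜 MuC
lemma3p4 𝓜 admits-ML translation 𝕊 𝕊∈𝓜 Σ' Σ-μc Σ-closed
  with translation 𝕊 𝕊∈𝓜 Σ' Σ-μc Σ-closed
... | V' , τ , τ-ML , V'≈V , 𝕊'∈𝓜 , τ[Σ]-closed , τ-□ , τ-agree =
  let 𝕋 , 𝕋∈𝓜 , 𝕋-filters-𝕊' = admits-ML 𝕊' 𝕊'∈𝓜 Γ Γ-ML Γ-closed
  in  𝕋 , 𝕋∈𝓜 , IsFiltration-transfer simulation 𝕋-filters-𝕊'
  where
    open Revaluation 𝕊 V'

    Γ : List Fm
    Γ = map τ Σ' ++ variables Σ'

    Γ-ML : All IsML Γ
    Γ-ML = ++⁺ (map⁺ (All.tabulate (τ-ML _))) (All.map IsVar⇒IsML (all-filter isVar? Σ'))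

    Γ-closed : FLClosed Γ
    Γ-closed = FLClosed-++ τ[Σ]-closed (FLClosed-variables Σ')

    simulation : Simulation Σ' Γ
    simulation = translation-simulation τ Σ-closed
      (λ p p∈Σ s → ⇔.sym (V'≈V p (var p , p∈Σ , o-var) s)) τ-□ τ-agree
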